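{- Let $\mathcal F$ be a group pair with $A$ as in the context. For each pair $(x,y)\in\mathcal E$ the following are equivalent: (i) there are $\alpha<\kappa_{xy}$ and $\beta<\kappa_{yx}$ such that $R_{xy,\alpha}^{ -1}=R_{yx,\beta}$; (ii) for every $\alpha<\kappa_{xy}$ there is $\beta<\kappa_{yx}$ such that $R_{xy,\alpha}^{ -1}=R_{yx,\beta}$; (iii) $\varphi_{xy}^{ -1}=\varphi_{yx}$. Moreover, suppose one of these conditions holds and the cosets of $H_{yx}$ are enumerated according to the convention in the context. Then $\kappa_{yx}=\kappa_{xy}$, and for each $\alpha$ the index $\beta$ in (i) and (ii) is uniquely determined by $H_{xy,\alpha}^{ -1}=H_{xy,\beta}$. Finally, $A$ is closed under relational converse if and only if (iii) holds for all $(x,y)\in\mathcal E$.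
   Context: A group pair consists of the following data. - Pairwise disjoint groups $G_x$ ($x\in I$), with operation $\circ$ and identity $e_x$. - An equivalence relation $\mathcal E$ on $I$. - For each $(x,y)\in\mathcal E$, an isomorphism $\varphi_{xy}:G_x/H_{xy}\to G_y/K_{xy}$, where $H_{xy}\trianglelefteq G_x$ and $K_{xy}\trianglelefteq G_y$. Write $X\circ Y=\{a\circ b:a\in X, b\in Y\}$ and $X^{ -1}=\{a^{ -1}:a\in X\}$. For each $(x,y)\in\mathcal E$ fix an enumeration without repetitions $\langle H_{xy,\gamma}:\gamma<\kappa_{xy}\rangle$ of the cosets of $H_{xy}$ in $G_x$, with $H_{xy,0}=H_{xy}$, and put $K_{xy,\gamma}=\varphi_{xy}(H_{xy,\gamma})$. Define $R_{xy,\alpha}=\bigcup_{\gamma<\kappa_{xy}}H_{xy,\gamma}\times(K_{xy,\gamma}\circ K_{xy,\alpha})$. Let $A$ be the set of all unions of subfamilies of the relations $R_{xy,\alpha}$. The converse of a relation is $R^{ -1}=\{(b,a):(a,b)\in R\}$. Convention: when $\varphi_{yx}=\varphi_{xy}^{ -1}$ (so that $H_{yx}=K_{xy}$ and $K_{yx}=H_{xy}$), the enumeration of the cosets of $H_{yx}$ is chosen with $\kappa_{yx}=\kappa_{xy}$ and $H_{yx,\gamma}=K_{xy,\gamma}$. Hence $K_{yx,\gamma}=H_{xy,\gamma}$. -}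

module Defs where

open import Level using (0ℓ)
open import Data.Product using (Σ; Σ-syntax; _×_; _,_)
open import Relation.Binary.PropositionalEquality using (_≡_)
open import Relation.Binary.Core using (Rel)
open import Relation.Binary.Structures using (IsEquivalence)
open import Relation.Unary using (Pred; _≐_)
open import Algebra.Structures using (IsGroup)
open import Algebra.Bundles.Raw using (RawGroup)
open import Algebra.Morphism.Structures using (IsGroupIsomorphism)

module SubsetOps {A : Set} (_∙_ : A → A → A) (inv : A → A) where

  _⊙_ : Pred A 0ℓ → Pred A 0ℓ → Pred A 0ℓ
  (X ⊙ Y) c = Σ[ a ∈ A ] Σ[ b ∈ A ] (X a × Y b × (a ∙ b) ≡ c)

  _⁻¹ˢ : Pred A 0ℓ → Pred A 0ℓ
  (X ⁻¹ˢ) c = Σ[ a ∈ A ] (X a × inv a ≡ c)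

  coset : Pred A 0ℓ → A → Pred A 0ℓ
  coset N a g = N (inv a ∙ g)

record IsNormalSubgroup {A : Set} (_∙_ : A → A → A) (e : A) (inv : A → A)
                        (N : Pred A 0ℓ) : Set where
  field
    e∈   : N e
    ∙∈   : ∀ {a b} → N a → N b → N (a ∙ b)
    inv∈ : ∀ {a} → N a → N (inv a)
    conj∈ : ∀ g {n} → N n → N ((g ∙ n) ∙ inv g)

Quotient : {A : Set} (_∙_ : A → A → A) (e : A) (inv : A → A) (N : Pred A 0ℓ) →
           RawGroup 0ℓ 0ℓ
Quotient {A} _∙_ e inv N = record
  { Carrier = A
  ; _≈_     = λ a b → N (a ∙ inv b)
  ; _∙_     = _∙_
  ; ε       = e
  ; _⁻¹     = inv
  }

-- The groups G_x are pairwise disjoint; their union is modelled as the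
-- disjoint sum  U = Σ I C.  Data attached to (x,y) ∈ E takes the proof of
-- (x,y) ∈ E as an *irrelevant* argument (membership is a proposition).
-- An isomorphism φ_xy : G_x/H_xy → G_y/K_xy is a map on representatives
-- which is a group isomorphism between the quotient groups.
-- The enumeration ⟨H_{xy,γ} : γ < κ_xy⟩ of the cosets of H_xy is given by
-- an index type κ_xy with a distinguished index 0, listing every coset of
-- H_xy exactly once, with H_{xy,0} = H_xy.

record GroupPair : Set₁ where
  field
    I       : Set
    C       : I → Set
    _∙_     : ∀ {x} → C x → C x → C x
    e       : ∀ x → C x
    inv     : ∀ {x} → C x → C x
    isGroup : ∀ x → IsGroup _≡_ (_∙_ {x}) (e x) (inv {x})

    E       : Rel I 0ℓ
    E-equiv : IsEquivalence E

    H       : ∀ x y → .(E x y) → Pred (C x) 0ℓ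
    K       : ∀ x y → .(E x y) → Pred (C y) 0ℓ
    H-normal : ∀ x y .(p : E x y) → IsNormalSubgroup _∙_ (e x) inv (H x y p)
    K-normal : ∀ x y .(p : E x y) → IsNormalSubgroup _∙_ (e y) inv (K x y p)
    φ       : ∀ x y → .(E x y) → C x → C y
    φ-iso   : ∀ x y .(p : E x y) →
              IsGroupIsomorphism (Quotient _∙_ (e x) inv (H x y p))
                                 (Quotient _∙_ (e y) inv (K x y p))
                                 (φ x y p)

    κ       : ∀ x y → .(E x y) → Set
    zero    : ∀ x y .(p : E x y) → κ x y p
    Hc      : ∀ x y .(p : E x y) → κ x y p → Pred (C x) 0ℓ
    Hc-coset : ∀ x y .(p : E x y) (γ : κ x y p) →
               Σ[ a ∈ C x ] (Hc x y p γ ≐ SubsetOps.coset _∙_ inv (H x y p) a)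
    Hc-all  : ∀ x y .(p : E x y) (a : C x) →
              Σ[ γ ∈ κ x y p ] (Hc x y p γ ≐ SubsetOps.coset _∙_ inv (H x y p) a)
    Hc-norep : ∀ x y .(p : E x y) (γ δ : κ x y p) →
               Hc x y p γ ≐ Hc x y p δ → γ ≡ δ
    Hc-zero : ∀ x y .(p : E x y) → Hc x y p (zero x y p) ≐ H x y p

module _ (𝓕 : GroupPair) where
  open GroupPair 𝓕

  U : Set
  U = Σ I C

  data Lift (x y : I) (S : C x → C y → Set) : U → U → Set where
    ⟨_⟩ : ∀ {a b} → S a b → Lift x y S (x , a) (y , b)

  -- K_{xy,γ} = φ_xy(H_{xy,γ})  (as a subset of G_y: the coset φ(a) K_xy, a ∈ H_{xy,γ})
  Kc : ∀ x y .(p : E x y) → κ x y p → Pred (C y) 0ℓ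
  Kc x y p γ b = Σ[ a ∈ C x ] (Hc x y p γ a × K x y p (inv (φ x y p a) ∙ b))

  R : ∀ x y .(p : E x y) → κ x y p → Rel U 0ℓ
  R x y p α = Lift x y (λ a b →
    Σ[ γ ∈ κ x y p ] (Hc x y p γ a × SubsetOps._⊙_ _∙_ inv (Kc x y p γ) (Kc x y p α) b))

  conv : Rel U 0ℓ → Rel U 0ℓ
  conv S u v = S v u

  Idx : Set
  Idx = Σ[ x ∈ I ] Σ[ y ∈ I ] Σ[ p ∈ E x y ] κ x y p

  Rᵢ : Idx → Rel U 0ℓ
  Rᵢ (x , y , p , α) = R x y p α

  ⋃ : Pred Idx 0ℓ → Rel U 0ℓ
  ⋃ P u v = Σ[ i ∈ Idx ] (P i × Rᵢ i u v)

  InA : Rel U 0ℓ → Set₁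
  InA S = Σ[ P ∈ Pred Idx 0ℓ ] (∀ u v → (S u v → ⋃ P u v) × (⋃ P u v → S u v))

  ConvClosed : Set₁
  ConvClosed = ∀ (S : Rel U 0ℓ) → InA S → InA (conv S)

  _≐ᵣ_ : Rel U 0ℓ → Rel U 0ℓ → Set
  S ≐ᵣ T = ∀ u v → (S u v → T u v) × (T u v → S u v)

  Esym : ∀ {x y} → E x y → E y x
  Esym = IsEquivalence.sym E-equiv

  -- (iii)  φ_xy⁻¹ = φ_yx : both maps G_y/K_xy = G_y/H_yx → G_x/H_xy = G_x/K_yx,
  -- i.e. the domains and codomains agree and φ_xy (φ_yx c) = c for all c.
  InvIso : ∀ x y → E x y → Set
  InvIso x y p =
    (H y x (Esym p) ≐ K x y p) × (K y x (Esym p) ≐ H x y p) ×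
    (∀ b → RawGroup._≈_ (Quotient _∙_ (e y) inv (K x y p))
                        (φ x y p (φ y x (Esym p) b)) b)

  CondI : ∀ x y → E x y → Set
  CondI x y p = Σ[ α ∈ κ x y p ] Σ[ β ∈ κ y x (Esym p) ]
                  (conv (R x y p α) ≐ᵣ R y x (Esym p) β)

  CondII : ∀ x y → E x y → Set
  CondII x y p = ∀ (α : κ x y p) → Σ[ β ∈ κ y x (Esym p) ]
                  (conv (R x y p α) ≐ᵣ R y x (Esym p) β)

  Convention : ∀ x y (p : E x y) → (κ x y p → κ y x (Esym p)) → Set
  Convention x y p σ = ∀ γ → Hc y x (Esym p) (σ γ) ≐ Kc x y p γ

-- All computations take place in quotient groups.  For (x,y) ∈ E
-- write f = φ_xy, g = φ_yx and rep γ for a representative of H_{xy,γ}.  The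
-- basic observation (Pair.R⇒≈, Pair.≈⇒R) is that R_{xy,α} relates a to b
-- exactly when b = f a ∙ f (rep α) modulo K_xy.  Then:
--  * a single inclusion conv R_{yx,β} ⊆ R_{xy,α} forces K_yx ⊆ H_xy and
--    f ∘ g = id modulo K_xy (Converse.inclusion⇒), so inclusions in both
--    directions give (iii) (inclusions⇒InvIso); this yields (i) ⇒ (iii) and,
--    as closure of A under converse provides such inclusions, closed ⇒ (iii);
--  * under (iii), both conv R_{xy,α} and R_{yx,β} say "a = g b ∙ constant" in
--    G_x/H_xy, so they coincide iff (rep α)⁻¹ = g (rep β) there
--    (UnderInvIso.converse⇔); this yields (iii) ⇒ (ii), the description of β
--    under the enumeration convention, and (iii) ⇒ closed.
module Submission where

open import Level using (0ℓ)
open import Data.Product using (Σ; Σ-syntax; _×_; _,_; proj₁; proj₂)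
open import Relation.Binary.PropositionalEquality
  using (_≡_; refl; sym; trans; cong; subst; module ≡-Reasoning)
open import Relation.Binary.Core using (Rel)
open import Relation.Binary.Bundles using (Setoid)
open import Relation.Binary.Structures using (IsEquivalence)
import Relation.Binary.Reasoning.Setoid as SetoidReasoning
open import Relation.Unary using (Pred; _⊆_; _≐_)
open import Function.Bundles using (_⇔_; mk⇔; module Equivalence)
open import Function.Construct.Composition using (_⇔-∘_)
open import Function.Definitions using (Bijective)
open import Algebra.Structures using (IsGroup)
open import Algebra.Bundles using (Group)
import Algebra.Properties.Group as GroupProperties
open import Algebra.Morphism.Structures using (IsGroupIsomorphism)

open import Defs

module QuotientGroup {A : Set} (_∙_ : A → A → A) (e : A) (inv : A → A)
                     (isGroup : IsGroup _≡_ _∙_ e inv)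
                     (N : Pred A 0ℓ) (normal : IsNormalSubgroup _∙_ e inv N) where

  private
    G : Group 0ℓ 0ℓ
    G = record { isGroup = isGroup }
    module G = Group G
    module GP = GroupProperties G
  open IsNormalSubgroup normal

  private
    infix 4 _~_
    _~_ : A → A → Set
    a ~ b = N (a ∙ inv b)

    rotate : ∀ {u v} → N (u ∙ v) → N (v ∙ u)
    rotate {u} {v} n = subst N rotated (conj∈ v n)
      where
      rotated : (v ∙ (u ∙ v)) ∙ inv v ≡ v ∙ u
      rotated = begin
        (v ∙ (u ∙ v)) ∙ inv v   ≡⟨ G.assoc v (u ∙ v) (inv v) ⟩
        v ∙ ((u ∙ v) ∙ inv v)   ≡⟨ cong (v ∙_) (GP.//-rightDividesʳ v u) ⟩
        v ∙ u                   ∎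
        where open ≡-Reasoning

    ~-refl : ∀ {a} → a ~ a
    ~-refl {a} = subst N (sym (G.inverseʳ a)) e∈

    ~-reflexive : ∀ {a b} → a ≡ b → a ~ b
    ~-reflexive refl = ~-refl

    ~-sym : ∀ {a b} → a ~ b → b ~ a
    ~-sym {a} {b} n = subst N inverted (inv∈ n)
      where
      inverted : inv (a ∙ inv b) ≡ b ∙ inv a
      inverted = begin
        inv (a ∙ inv b)        ≡⟨ GP.⁻¹-anti-homo-∙ a (inv b) ⟩
        inv (inv b) ∙ inv a    ≡⟨ cong (_∙ inv a) (GP.⁻¹-involutive b) ⟩
        b ∙ inv a              ∎
        where open ≡-Reasoning

    ~-trans : ∀ {a b c} → a ~ b → b ~ c → a ~ c
    ~-trans {a} {b} {c} m n = subst N telescoped (∙∈ m n)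
      where
      telescoped : (a ∙ inv b) ∙ (b ∙ inv c) ≡ a ∙ inv c
      telescoped = begin
        (a ∙ inv b) ∙ (b ∙ inv c)   ≡⟨ G.assoc a (inv b) (b ∙ inv c) ⟩
        a ∙ (inv b ∙ (b ∙ inv c))   ≡⟨ cong (a ∙_) (GP.\\-leftDividesʳ b (inv c)) ⟩
        a ∙ inv c                   ∎
        where open ≡-Reasoning

    ~-∙-congˡ : ∀ a {b b'} → b ~ b' → (a ∙ b) ~ (a ∙ b')
    ~-∙-congˡ a {b} {b'} n = subst N (sym conjugated) (conj∈ a n)
      where
      conjugated : (a ∙ b) ∙ inv (a ∙ b') ≡ (a ∙ (b ∙ inv b')) ∙ inv a
      conjugated = begin
        (a ∙ b) ∙ inv (a ∙ b')        ≡⟨ cong ((a ∙ b) ∙_) (GP.⁻¹-anti-homo-∙ a b') ⟩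
        (a ∙ b) ∙ (inv b' ∙ inv a)    ≡⟨ G.assoc (a ∙ b) (inv b') (inv a) ⟨
        ((a ∙ b) ∙ inv b') ∙ inv a    ≡⟨ cong (_∙ inv a) (G.assoc a b (inv b')) ⟩
        (a ∙ (b ∙ inv b')) ∙ inv a    ∎
        where open ≡-Reasoning

    ~-∙-congʳ : ∀ {a a'} b → a ~ a' → (a ∙ b) ~ (a' ∙ b)
    ~-∙-congʳ {a} {a'} b n = subst N (sym cancelled) n
      where
      cancelled : (a ∙ b) ∙ inv (a' ∙ b) ≡ a ∙ inv a'
      cancelled = begin
        (a ∙ b) ∙ inv (a' ∙ b)        ≡⟨ cong ((a ∙ b) ∙_) (GP.⁻¹-anti-homo-∙ a' b) ⟩
        (a ∙ b) ∙ (inv b ∙ inv a')    ≡⟨ G.assoc (a ∙ b) (inv b) (inv a') ⟨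
        ((a ∙ b) ∙ inv b) ∙ inv a'    ≡⟨ cong (_∙ inv a') (GP.//-rightDividesʳ b a) ⟩
        a ∙ inv a'                    ∎
        where open ≡-Reasoning

    ~-∙-cong : ∀ {a a' b b'} → a ~ a' → b ~ b' → (a ∙ b) ~ (a' ∙ b')
    ~-∙-cong {a' = a'} {b = b} m n = ~-trans (~-∙-congʳ b m) (~-∙-congˡ a' n)

    ~-isEquivalence : IsEquivalence _~_
    ~-isEquivalence = record { refl = ~-refl ; sym = ~-sym ; trans = ~-trans }

    ~-setoid : Setoid 0ℓ 0ℓ
    ~-setoid = record { isEquivalence = ~-isEquivalence }

    ~-⁻¹-cong : ∀ {a b} → a ~ b → inv a ~ inv b
    ~-⁻¹-cong {a} {b} n = begin
      inv a                      ≡⟨ GP.//-rightDividesʳ b (inv a) ⟨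
      (inv a ∙ b) ∙ inv b        ≈⟨ ~-∙-congʳ (inv b) (~-∙-congˡ (inv a) (~-sym n)) ⟩
      (inv a ∙ a) ∙ inv b        ≡⟨ cong (_∙ inv b) (G.inverseˡ a) ⟩
      e ∙ inv b                  ≡⟨ G.identityˡ (inv b) ⟩
      inv b                      ∎
      where open SetoidReasoning ~-setoid

  quotient : Group 0ℓ 0ℓ
  quotient = record
    { _≈_ = _~_ ; _∙_ = _∙_ ; ε = e ; _⁻¹ = inv
    ; isGroup = record
      { isMonoid = record
        { isSemigroup = record
          { isMagma = record { isEquivalence = ~-isEquivalence ; ∙-cong = ~-∙-cong }
          ; assoc = λ a b c → ~-reflexive (G.assoc a b c) }
        ; identity = (λ a → ~-reflexive (G.identityˡ a)) , (λ a → ~-reflexive (G.identityʳ a)) }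
      ; inverse = (λ a → ~-reflexive (G.inverseˡ a)) , (λ a → ~-reflexive (G.inverseʳ a))
      ; ⁻¹-cong = ~-⁻¹-cong } }

  open Group quotient public
    using (_≈_; ∙-cong; ∙-congˡ; ∙-congʳ; ⁻¹-cong; assoc; identityˡ; identityʳ; setoid)
    renaming (refl to ≈-refl; reflexive to ≈-reflexive; sym to ≈-sym; trans to ≈-trans)
  open GroupProperties quotient public using (∙-cancelˡ; x≈z//y)

  module ≈-Reasoning = SetoidReasoning setoid

  ∈N⇒≈e : ∀ {a} → N a → a ≈ e
  ∈N⇒≈e {a} = subst N (sym (trans (cong (a ∙_) GP.ε⁻¹≈ε) (G.identityʳ a)))

  ≈e⇒∈N : ∀ {a} → a ≈ e → N a
  ≈e⇒∈N {a} = subst N (trans (cong (a ∙_) GP.ε⁻¹≈ε) (G.identityʳ a))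

  coset⇒≈ : ∀ {a g} → SubsetOps.coset _∙_ inv N a g → g ≈ a
  coset⇒≈ = rotate

  ≈⇒coset : ∀ {a g} → g ≈ a → SubsetOps.coset _∙_ inv N a g
  ≈⇒coset = rotate

module _ (𝓕 : GroupPair) where
  open GroupPair 𝓕

  group : I → Group 0ℓ 0ℓ
  group x = record { isGroup = isGroup x }

  module Pair (x y : I) (p : E x y) where
    module Hq = QuotientGroup (_∙_ {x}) (e x) inv (isGroup x) (H x y p) (H-normal x y p)
    module Kq = QuotientGroup (_∙_ {y}) (e y) inv (isGroup y) (K x y p) (K-normal x y p)

    module Gx = GroupProperties (group x)
    module Gy = GroupProperties (group y)

    f : C x → C y
    f = φ x y p

    open IsGroupIsomorphism (φ-iso x y p) public
      using ()
      renaming (⟦⟧-cong to f-cong; ∙-homo to f-homo; ε-homo to f-ε; injective to f-injective)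

    rep : κ x y p → C x
    rep γ = proj₁ (Hc-coset x y p γ)

    ∈Hc⇒≈rep : ∀ {γ g} → Hc x y p γ g → g Hq.≈ rep γ
    ∈Hc⇒≈rep {γ} g∈ = Hq.coset⇒≈ (proj₁ (proj₂ (Hc-coset x y p γ)) g∈)

    ≈rep⇒∈Hc : ∀ {γ g} → g Hq.≈ rep γ → Hc x y p γ g
    ≈rep⇒∈Hc {γ} g≈ = proj₂ (proj₂ (Hc-coset x y p γ)) (Hq.≈⇒coset g≈)

    index : C x → κ x y p
    index a = proj₁ (Hc-all x y p a)

    ∈Hc-index : ∀ a → Hc x y p (index a) a
    ∈Hc-index a = proj₂ (proj₂ (Hc-all x y p a)) (Hq.≈⇒coset Hq.≈-refl)

    rep-injective : ∀ {γ δ} → rep γ Hq.≈ rep δ → γ ≡ δ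
    rep-injective {γ} {δ} r≈ = Hc-norep x y p γ δ
      ( (λ g∈ → ≈rep⇒∈Hc (Hq.≈-trans (∈Hc⇒≈rep g∈) r≈))
      , (λ g∈ → ≈rep⇒∈Hc (Hq.≈-trans (∈Hc⇒≈rep g∈) (Hq.≈-sym r≈))) )

    ∈Kc⇒≈ : ∀ {γ b} → Kc 𝓕 x y p γ b → b Kq.≈ f (rep γ)
    ∈Kc⇒≈ (a , a∈ , b∈) = Kq.≈-trans (Kq.coset⇒≈ b∈) (f-cong (∈Hc⇒≈rep a∈))

    ≈⇒∈Kc : ∀ {γ b} → b Kq.≈ f (rep γ) → Kc 𝓕 x y p γ b
    ≈⇒∈Kc {γ} b≈ = rep γ , ≈rep⇒∈Hc Hq.≈-refl , Kq.≈⇒coset b≈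

    R⇒≈ : ∀ {α a b} → R 𝓕 x y p α (x , a) (y , b) → b Kq.≈ f a ∙ f (rep α)
    R⇒≈ ⟨ γ , a∈ , b₁ , b₂ , b₁∈ , b₂∈ , refl ⟩ =
      Kq.∙-cong (Kq.≈-trans (∈Kc⇒≈ b₁∈) (f-cong (Hq.≈-sym (∈Hc⇒≈rep a∈)))) (∈Kc⇒≈ b₂∈)

    -- witness: γ the coset of a, and b = f a ∙ (f a)⁻¹ b with f a ∈ K_{xy,γ}
    ≈⇒R : ∀ {α a b} → b Kq.≈ f a ∙ f (rep α) → R 𝓕 x y p α (x , a) (y , b)
    ≈⇒R {α} {a} {b} b≈ =
      ⟨ index a , ∈Hc-index a , f a , inv (f a) ∙ b
      , (a , ∈Hc-index a , Kq.≈⇒coset Kq.≈-refl) , ≈⇒∈Kc quotient≈ , Gy.\\-leftDividesˡ (f a) b ⟩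
      where
      quotient≈ : inv (f a) ∙ b Kq.≈ f (rep α)
      quotient≈ = begin
        inv (f a) ∙ b                   ≈⟨ Kq.∙-congˡ b≈ ⟩
        inv (f a) ∙ (f a ∙ f (rep α))   ≡⟨ Gy.\\-leftDividesʳ (f a) (f (rep α)) ⟩
        f (rep α)                       ∎
        where open Kq.≈-Reasoning

    inverse-coset⇔ : ∀ α δ →
      (SubsetOps._⁻¹ˢ _∙_ inv (Hc x y p α) ≐ Hc x y p δ) ⇔ (inv (rep α) Hq.≈ rep δ)
    inverse-coset⇔ α δ =
      mk⇔ (λ (sub , _) → ∈Hc⇒≈rep (sub (rep α , ≈rep⇒∈Hc Hq.≈-refl , refl))) cosets
      where
      cosets : inv (rep α) Hq.≈ rep δ → SubsetOps._⁻¹ˢ _∙_ inv (Hc x y p α) ≐ Hc x y p δ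
      cosets r≈ = (λ { (a , a∈ , refl) → ≈rep⇒∈Hc (Hq.≈-trans (Hq.⁻¹-cong (∈Hc⇒≈rep a∈)) r≈) })
                , λ {g} g∈ → inv g , ≈rep⇒∈Hc (inv-g≈ (∈Hc⇒≈rep g∈)) , Gx.⁻¹-involutive g
        where
        inv-g≈ : ∀ {g} → g Hq.≈ rep δ → inv g Hq.≈ rep α
        inv-g≈ {g} g≈ = begin
          inv g               ≈⟨ Hq.⁻¹-cong (Hq.≈-trans g≈ (Hq.≈-sym r≈)) ⟩
          inv (inv (rep α))   ≡⟨ Gx.⁻¹-involutive (rep α) ⟩
          rep α               ∎
          where open Hq.≈-Reasoning

  ConvInclusion : ∀ x y (p : E x y) → κ y x (Esym 𝓕 p) → κ x y p → Set
  ConvInclusion x y p β α =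
    ∀ a b → R 𝓕 y x (Esym 𝓕 p) β (y , b) (x , a) → R 𝓕 x y p α (x , a) (y , b)

  module Converse (x y : I) (p : E x y) where
    module A = Pair x y p
    module B = Pair y x (Esym 𝓕 p)

    -- Half of (i) ⇒ (iii): one inclusion conv R_{yx,β} ⊆ R_{xy,α} already
    -- forces K_yx ⊆ H_xy (K'⊆H) and f ∘ g = id on G_y/K_xy (fg≈id).
    module FromInclusion {β α} (incl : ConvInclusion x y p β α) where
      c : C y
      c = A.f (A.rep α)
      d : C x
      d = B.f (B.rep β)

      premise : ∀ a b → a B.Kq.≈ B.f b ∙ d → b A.Kq.≈ A.f a ∙ c
      premise a b a≈ = A.R⇒≈ (incl a b (B.≈⇒R a≈))

      -- instantiating at a = g b ∙ d:  b = f (g b) ∙ t  with t independent of b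
      t : C y
      t = A.f d ∙ c

      shifted : ∀ b → b A.Kq.≈ A.f (B.f b) ∙ t
      shifted b = begin
        b                             ≈⟨ premise (B.f b ∙ d) b B.Kq.≈-refl ⟩
        A.f (B.f b ∙ d) ∙ c           ≈⟨ A.Kq.∙-congʳ (A.f-homo (B.f b) d) ⟩
        (A.f (B.f b) ∙ A.f d) ∙ c     ≈⟨ A.Kq.assoc (A.f (B.f b)) (A.f d) c ⟩
        A.f (B.f b) ∙ t               ∎
        where open A.Kq.≈-Reasoning

      -- for k ∈ K_yx, a = k ∙ w is K_yx-equivalent to w = g e ∙ d, so f k = e
      K'⊆H : K y x (Esym 𝓕 p) ⊆ H x y p
      K'⊆H {k} k∈ = A.Hq.≈e⇒∈N (A.f-injective fk≈fe)
        where
        w : C x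
        w = B.f (e y) ∙ d
        kw≈w : k ∙ w B.Kq.≈ B.f (e y) ∙ d
        kw≈w = B.Kq.≈-trans (B.Kq.∙-congʳ (B.Kq.∈N⇒≈e k∈)) (B.Kq.identityˡ w)
        fk≈fe : A.f k A.Kq.≈ A.f (e x)
        fk≈fe = begin
          A.f k                     ≈⟨ A.Kq.identityʳ (A.f k) ⟨
          A.f k ∙ e y               ≈⟨ A.Kq.∙-congˡ (premise w (e y) B.Kq.≈-refl) ⟩
          A.f k ∙ (A.f w ∙ c)       ≈⟨ A.Kq.assoc (A.f k) (A.f w) c ⟨
          (A.f k ∙ A.f w) ∙ c       ≈⟨ A.Kq.∙-congʳ (A.f-homo k w) ⟨
          A.f (k ∙ w) ∙ c           ≈⟨ premise (k ∙ w) (e y) kw≈w ⟨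
          e y                       ≈⟨ A.f-ε ⟨
          A.f (e x)                 ∎
          where open A.Kq.≈-Reasoning

      -- K'⊆H applied to g e ∈ K_yx gives f (g e) = e, hence t = e, hence f ∘ g = id
      fge≈e : A.f (B.f (e y)) A.Kq.≈ e y
      fge≈e = A.Kq.≈-trans (A.f-cong (K'⊆H B.f-ε)) A.f-ε

      t≈e : t A.Kq.≈ e y
      t≈e = begin
        t                       ≈⟨ A.Kq.identityˡ t ⟨
        e y ∙ t                 ≈⟨ A.Kq.∙-congʳ fge≈e ⟨
        A.f (B.f (e y)) ∙ t     ≈⟨ shifted (e y) ⟨
        e y                     ∎
        where open A.Kq.≈-Reasoning

      fg≈id : ∀ b → A.f (B.f b) A.Kq.≈ b
      fg≈id b = begin
        A.f (B.f b)             ≈⟨ A.Kq.identityʳ (A.f (B.f b)) ⟨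
        A.f (B.f b) ∙ e y       ≈⟨ A.Kq.∙-congˡ t≈e ⟨
        A.f (B.f b) ∙ t         ≈⟨ shifted b ⟨
        b                       ∎
        where open A.Kq.≈-Reasoning

    -- If K_xy ⊆ H_yx and g ∘ f = id on G_x/K_yx, then H_xy ⊆ K_yx:
    -- h ∈ H_xy gives f h ∈ K_xy ⊆ H_yx, hence h = g (f h) = g e = e mod K_yx.
    H⊆K' : K x y p ⊆ H y x (Esym 𝓕 p) → (∀ a → B.f (A.f a) B.Kq.≈ a) →
           H x y p ⊆ K y x (Esym 𝓕 p)
    H⊆K' K⊆H' gf≈id {h} h∈ = B.Kq.≈e⇒∈N (begin
      h               ≈⟨ gf≈id h ⟨
      B.f (A.f h)     ≈⟨ B.f-cong fh≈e ⟩
      B.f (e y)       ≈⟨ B.f-ε ⟩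
      e x             ∎)
      where
      open B.Kq.≈-Reasoning
      fh≈e : A.f h B.Hq.≈ e y
      fh≈e = K⊆H' (A.Kq.≈-trans (A.f-cong (A.Hq.∈N⇒≈e h∈)) A.f-ε)

  inclusions⇒InvIso : ∀ x y (p : E x y) {α β α' β'} →
    ConvInclusion x y p β α → ConvInclusion y x (Esym 𝓕 p) α' β' → InvIso 𝓕 x y p
  inclusions⇒InvIso x y p incl incl' =
      (Converse.H⊆K' y x (Esym 𝓕 p) K'⊆H fg≈id , K⊆H')
    , (K'⊆H , Converse.H⊆K' x y p K⊆H' gf≈id)
    , fg≈id
    where
    open Converse.FromInclusion x y p incl using (K'⊆H; fg≈id)
    open Converse.FromInclusion y x (Esym 𝓕 p) incl' renaming (K'⊆H to K⊆H'; fg≈id to gf≈id)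

  -- Under (iii) both R_{xy,α} and the converse of R_{yx,β} become relations
  -- "a = g b ∙ constant" in G_x/H_xy, so they agree iff the constants agree.
  module UnderInvIso (x y : I) (p : E x y) (iii : InvIso 𝓕 x y p) where
    open Converse x y p using (module A; module B)

    private
      H'≐K : H y x (Esym 𝓕 p) ≐ K x y p
      H'≐K = proj₁ iii
      K'≐H : K y x (Esym 𝓕 p) ≐ H x y p
      K'≐H = proj₁ (proj₂ iii)
      fg≈id : ∀ b → A.f (B.f b) A.Kq.≈ b
      fg≈id = proj₂ (proj₂ iii)

    g-inverts : ∀ {a b} → b A.Kq.≈ A.f a → B.f b A.Hq.≈ a
    g-inverts {a} {b} b≈ = A.f-injective (A.Kq.≈-trans (fg≈id b) b≈)

    R⇔ : ∀ {α a b} → R 𝓕 x y p α (x , a) (y , b) ⇔ (a A.Hq.≈ B.f b ∙ inv (A.rep α))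
    R⇔ {α} {a} {b} = mk⇔
      (λ r → A.Hq.x≈z//y a (A.rep α) (B.f b)
               (A.Hq.≈-sym (g-inverts (A.Kq.≈-trans (A.R⇒≈ r) (A.Kq.≈-sym (A.f-homo a (A.rep α)))))))
      (λ a≈ → A.≈⇒R (begin
        b                       ≈⟨ fg≈id b ⟨
        A.f (B.f b)             ≈⟨ A.f-cong (gb≈ a≈) ⟩
        A.f (a ∙ A.rep α)       ≈⟨ A.f-homo a (A.rep α) ⟩
        A.f a ∙ A.f (A.rep α)   ∎))
      where
      open A.Kq.≈-Reasoning
      gb≈ : a A.Hq.≈ B.f b ∙ inv (A.rep α) → B.f b A.Hq.≈ a ∙ A.rep α
      gb≈ a≈ = A.Hq.≈-trans (A.Hq.≈-reflexive (sym (A.Gx.//-rightDividesˡ (A.rep α) (B.f b))))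
                            (A.Hq.∙-congʳ (A.Hq.≈-sym a≈))

    R'⇔ : ∀ {β a b} → R 𝓕 y x (Esym 𝓕 p) β (y , b) (x , a) ⇔ (a A.Hq.≈ B.f b ∙ B.f (B.rep β))
    R'⇔ = mk⇔ (λ r → proj₁ K'≐H (B.R⇒≈ r)) (λ a≈ → B.≈⇒R (proj₂ K'≐H a≈))

    converse⇔ : ∀ α β → (_≐ᵣ_ 𝓕 (conv 𝓕 (R 𝓕 x y p α)) (R 𝓕 y x (Esym 𝓕 p) β))
                        ⇔ (inv (A.rep α) A.Hq.≈ B.f (B.rep β))
    converse⇔ α β = mk⇔ constants-agree relations-agree
      where
      -- test the equality on a = g e ∙ (rep α)⁻¹, b = e and cancel g e
      constants-agree : _≐ᵣ_ 𝓕 (conv 𝓕 (R 𝓕 x y p α)) (R 𝓕 y x (Esym 𝓕 p) β) →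
                        inv (A.rep α) A.Hq.≈ B.f (B.rep β)
      constants-agree eq = A.Hq.∙-cancelˡ (B.f (e y)) (inv (A.rep α)) (B.f (B.rep β))
        (Equivalence.to R'⇔ (proj₁ (eq (y , e y) (x , a₀)) (Equivalence.from R⇔ A.Hq.≈-refl)))
        where
        a₀ : C x
        a₀ = B.f (e y) ∙ inv (A.rep α)

      relations-agree : inv (A.rep α) A.Hq.≈ B.f (B.rep β) →
                        _≐ᵣ_ 𝓕 (conv 𝓕 (R 𝓕 x y p α)) (R 𝓕 y x (Esym 𝓕 p) β)
      relations-agree c≈ _ _ = to , from
        where
        to : ∀ {u v} → R 𝓕 x y p α v u → R 𝓕 y x (Esym 𝓕 p) β u v
        to ⟨ r ⟩ = Equivalence.from R'⇔
          (A.Hq.≈-trans (Equivalence.to R⇔ ⟨ r ⟩) (A.Hq.∙-congˡ c≈))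
        from : ∀ {u v} → R 𝓕 y x (Esym 𝓕 p) β u v → R 𝓕 x y p α v u
        from ⟨ r ⟩ = Equivalence.from R⇔
          (A.Hq.≈-trans (Equivalence.to R'⇔ ⟨ r ⟩) (A.Hq.∙-congˡ (A.Hq.≈-sym c≈)))

    -- (iii) ⇒ (ii): for α take β the index of the coset of f ((rep α)⁻¹) in G_y.
    condII : CondII 𝓕 x y p
    condII α = β , Equivalence.from (converse⇔ α β)
      (A.Hq.≈-sym (g-inverts (proj₁ H'≐K (B.Hq.≈-sym (B.∈Hc⇒≈rep (B.∈Hc-index c))))))
      where
      c : C y
      c = A.f (inv (A.rep α))
      β : κ y x (Esym 𝓕 p)
      β = B.index c

    -- With the enumeration convention H_{yx,σ γ} = K_{xy,γ}, σ is a bijection and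
    -- g (rep (σ δ)) = rep δ, so the converse condition becomes (rep α)⁻¹ ∈ H_{xy,δ}.
    module WithConvention (σ : κ x y p → κ y x (Esym 𝓕 p)) (convention : Convention 𝓕 x y p σ) where

      -- rep (σ γ) ∈ H_{yx,σ γ} = K_{xy,γ}
      rep-σ : ∀ γ → B.rep (σ γ) A.Kq.≈ A.f (A.rep γ)
      rep-σ γ = A.∈Kc⇒≈ (proj₁ (convention γ) (B.≈rep⇒∈Hc B.Hq.≈-refl))

      σ-bijective : Bijective _≡_ _≡_ σ
      σ-bijective = σ-injective , σ-surjective
        where
        σ-injective : ∀ {γ δ} → σ γ ≡ σ δ → γ ≡ δ
        σ-injective {γ} {δ} σγ≡σδ = A.rep-injective (A.f-injective
          (A.Kq.≈-trans (A.Kq.≈-sym rep-σδ) (rep-σ δ)))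
          where
          rep-σδ : B.rep (σ δ) A.Kq.≈ A.f (A.rep γ)
          rep-σδ = subst (λ β → B.rep β A.Kq.≈ A.f (A.rep γ)) σγ≡σδ (rep-σ γ)

        -- β is hit by the index of the coset of g (rep β)
        σ-surjective : ∀ β → Σ[ γ ∈ κ x y p ] (∀ {z} → z ≡ γ → σ z ≡ β)
        σ-surjective β = A.index (B.f (B.rep β)) , λ { refl → B.rep-injective (proj₂ H'≐K (begin
          B.rep (σ (A.index (B.f (B.rep β))))   ≈⟨ rep-σ _ ⟩
          A.f (A.rep (A.index (B.f (B.rep β)))) ≈⟨ A.f-cong (A.Hq.≈-sym (A.∈Hc⇒≈rep (A.∈Hc-index _))) ⟩
          A.f (B.f (B.rep β))                   ≈⟨ fg≈id (B.rep β) ⟩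
          B.rep β                               ∎)) }
          where open A.Kq.≈-Reasoning

      converse-σ⇔ : ∀ α δ →
        (_≐ᵣ_ 𝓕 (conv 𝓕 (R 𝓕 x y p α)) (R 𝓕 y x (Esym 𝓕 p) (σ δ)))
        ⇔ (SubsetOps._⁻¹ˢ _∙_ inv (Hc x y p α) ≐ Hc x y p δ)
      converse-σ⇔ α δ = constant⇔inverse-coset ⇔-∘ converse⇔ α (σ δ)
        where
        g-rep-σ : B.f (B.rep (σ δ)) A.Hq.≈ A.rep δ
        g-rep-σ = g-inverts (rep-σ δ)
        constant⇔inverse-coset : (inv (A.rep α) A.Hq.≈ B.f (B.rep (σ δ)))
                          ⇔ (SubsetOps._⁻¹ˢ _∙_ inv (Hc x y p α) ≐ Hc x y p δ)
        constant⇔inverse-coset = mk⇔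
          (λ c≈ → Equivalence.from (A.inverse-coset⇔ α δ) (A.Hq.≈-trans c≈ g-rep-σ))
          (λ inv≐ → A.Hq.≈-trans (Equivalence.to (A.inverse-coset⇔ α δ) inv≐) (A.Hq.≈-sym g-rep-σ))

  condI⇒InvIso : ∀ x y (p : E x y) → CondI 𝓕 x y p → InvIso 𝓕 x y p
  condI⇒InvIso x y p (α , β , conv≐) = inclusions⇒InvIso x y p {α} {β} {α} {β}
    (λ a b r → proj₂ (conv≐ (y , b) (x , a)) r)
    (λ b a r → proj₁ (conv≐ (y , b) (x , a)) r)

  -- (i) ⇒ (iii) ⇒ (ii) ⇒ (i), the last step taking α = 0
  equivalences : ∀ x y (p : E x y) →
    (CondI 𝓕 x y p ⇔ InvIso 𝓕 x y p) × (CondII 𝓕 x y p ⇔ InvIso 𝓕 x y p)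
  equivalences x y p =
      mk⇔ (condI⇒InvIso x y p) (λ iii → zero x y p , UnderInvIso.condII x y p iii (zero x y p))
    , mk⇔ (λ ii → condI⇒InvIso x y p (zero x y p , ii (zero x y p))) (UnderInvIso.condII x y p)

  -- If A is closed under converse, conv R_{xy,0} is a union of relations R_j;
  -- the R_j containing one pair of conv R_{xy,0} is some R_{yx,β}, and then
  -- conv R_{yx,β} ⊆ R_{xy,0}.
  closure⇒inclusion : ConvClosed 𝓕 → ∀ x y (p : E x y) →
                      Σ[ β ∈ κ y x (Esym 𝓕 p) ] ConvInclusion x y p β (zero x y p)
  closure⇒inclusion closed x y p = inclusion (closed R₀ R₀∈A)
    where
    open Pair x y p
    R₀ : Rel (U 𝓕) 0ℓ
    R₀ = R 𝓕 x y p (zero x y p)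

    -- R_{xy,0} itself is in A: the union of the one-element family
    R₀∈A : InA 𝓕 R₀
    R₀∈A = (_≡ (x , y , p , zero x y p)) , λ _ _ → (λ r → _ , refl , r) , λ { (_ , refl , r) → r }

    -- (e, b₀) ∈ R_{xy,0}
    b₀ : C y
    b₀ = f (e x) ∙ f (rep (zero x y p))

    inclusion : InA 𝓕 (conv 𝓕 R₀) → Σ[ β ∈ κ y x (Esym 𝓕 p) ] ConvInclusion x y p β (zero x y p)
    inclusion (P , conv≐⋃P) = witness (proj₁ (conv≐⋃P (y , b₀) (x , e x)) (≈⇒R Kq.≈-refl))
      where
      witness : ⋃ 𝓕 P (y , b₀) (x , e x) →
                Σ[ β ∈ κ y x (Esym 𝓕 p) ] ConvInclusion x y p β (zero x y p)
      witness ((_ , _ , q , β) , β∈P , ⟨ _ ⟩) =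
        β , λ a b r → proj₂ (conv≐⋃P (y , b) (x , a)) ((y , x , q , β) , β∈P , r)

  closure⇒InvIso : ConvClosed 𝓕 → ∀ x y (p : E x y) → InvIso 𝓕 x y p
  closure⇒InvIso closed x y p = inclusions⇒InvIso x y p
    (proj₂ (closure⇒inclusion closed x y p)) (proj₂ (closure⇒inclusion closed y x (Esym 𝓕 p)))

  -- Conversely, under (iii) the converse of each R_{xy,α} is some R_{yx,β}, so
  -- the converse of a union of R_i's is the union of their converses.
  InvIso⇒closure : (∀ x y (p : E x y) → InvIso 𝓕 x y p) → ConvClosed 𝓕
  InvIso⇒closure iii S (P , S≐⋃P) = P' , λ _ _ → to , from
    where
    P' : Pred (Idx 𝓕) 0ℓ
    P' j = Σ[ i ∈ Idx 𝓕 ] (P i × _≐ᵣ_ 𝓕 (conv 𝓕 (Rᵢ 𝓕 i)) (Rᵢ 𝓕 j))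

    converse-member : ∀ {u v} → ⋃ 𝓕 P v u → ⋃ 𝓕 P' u v
    converse-member {u} {v} ((x , y , p , α) , α∈P , r) =
      (y , x , Esym 𝓕 p , β) , ((x , y , p , α) , α∈P , conv≐) , proj₁ (conv≐ u v) r
      where
      open Σ (UnderInvIso.condII x y p (iii x y p) α) renaming (proj₁ to β; proj₂ to conv≐)

    to : ∀ {u v} → S v u → ⋃ 𝓕 P' u v
    to {u} {v} s = converse-member (proj₁ (S≐⋃P v u) s)

    from : ∀ {u v} → ⋃ 𝓕 P' u v → S v u
    from (_ , (i , i∈P , conv≐) , r) = proj₂ (S≐⋃P _ _) (i , i∈P , proj₂ (conv≐ _ _) r)

theorem3p8 : (𝓕 : GroupPair) → let open GroupPair 𝓕 in
    -- (i) ⇔ (iii) and (ii) ⇔ (iii), for every (x,y) ∈ E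
    (∀ x y (p : E x y) →
       (CondI 𝓕 x y p ⇔ InvIso 𝓕 x y p) × (CondII 𝓕 x y p ⇔ InvIso 𝓕 x y p))
    ×
    -- under the conditions and the enumeration convention (σ identifies
    -- the indices), κ_yx = κ_xy (σ is a bijection) and β is determined by
    -- H_{xy,α}⁻¹ = H_{xy,β}
    (∀ x y (p : E x y) → InvIso 𝓕 x y p →
       (σ : κ x y p → κ y x (Esym 𝓕 p)) → Convention 𝓕 x y p σ →
       Bijective _≡_ _≡_ σ ×
       (∀ (α δ : κ x y p) →
          (_≐ᵣ_ 𝓕 (conv 𝓕 (R 𝓕 x y p α)) (R 𝓕 y x (Esym 𝓕 p) (σ δ)))
          ⇔ (SubsetOps._⁻¹ˢ _∙_ inv (Hc x y p α) ≐ Hc x y p δ)))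
    ×
    -- A is closed under converse iff (iii) holds for all (x,y) ∈ E
    (ConvClosed 𝓕 ⇔ (∀ x y (p : E x y) → InvIso 𝓕 x y p))
theorem3p8 𝓕 =
    equivalences 𝓕
  , (λ x y p iii σ convention →
       let open UnderInvIso 𝓕 x y p iii; open WithConvention σ convention
       in σ-bijective , converse-σ⇔)
  , mk⇔ (closure⇒InvIso 𝓕) (InvIso⇒closure 𝓕)
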